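{- Let $(X,d)$ be a finite metric space, $\eta<1$ and $\mu>1$. If there is an $(\eta,\mu)$-Hierarchical Partition Family of $X$ of size $k$, then there is a tree cover of $X$ with distortion $\mu/\eta$ and size $k$.
   Context: $B(x,r)=\{y\in X:d(x,y)\le r\}$. Let $d_{\max}=\max_{x\ne y}d(x,y)$, $\Phi(X)=d_{\max}/\min_{x\ne y}d(x,y)$, with $\log_\mu\Phi(X)$ assumed an integer. A $\Delta$-bounded partition of $X$ is a partition into pairwise disjoint clusters of diameter at most $\Delta$; $P(x)$ is the cluster containing $x$. A $\mu$-Hierarchical Partition of $X$ is a collection $\{P_0,\dots,P_B\}$, $B=\log_\mu\Phi(X)$, where with $\Delta_i=d_{\max}/\mu^i$ each $P_i$ is $\Delta_i$-bounded and $P_{i+1}$ refines $P_i$. An $(\eta,\mu)$-Hierarchical Partition Family of $X$ is a set $\{H^j\}$ of $\mu$-Hierarchical Partitions such that for all $x\in X$ and all $0\le i\le \log_\mu\Phi(X)$ there is $j$ with $B(x,\eta\Delta_i)\subseteq P_i^{(j)}(x)$ ($P_i^{(j)}$ the $i$-th partition of $H^j$); its size is the number of its members. An edge-weighted tree $T$ with $X\subseteq V(T)$ is dominating if $d_T\ge d$ on $X$; a tree cover of distortion $\alpha$ and size $k$ is a collection of $k$ dominating trees such that every pair $u\ne v$ in $X$ satisfies $d_{T_i}(u,v)\le\alpha d(u,v)$ for some $i$. -}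

module Defs where

open import Level using (0ℓ)
open import Data.Nat using (ℕ; zero; suc) renaming (_<_ to _<ℕ_; _≤_ to _≤ℕ_)
open import Data.Fin using (Fin)
open import Data.Maybe using (Maybe; just; nothing)
open import Data.Product using (Σ; ∃; ∃-syntax; _×_; _,_)
open import Relation.Nullary using (¬_)
open import Relation.Binary.PropositionalEquality using (_≡_; _≢_)
open import Algebra.Structures using (IsCommutativeRing)
open import Relation.Binary.Structures using (IsTotalOrder)

-- Ordered fields (the stdlib has no real numbers).  The theorem is
-- stated for an arbitrary ordered field, which in particular covers ℝ.

record OrderedField : Set₁ where
  infixl 7 _*_
  infixl 6 _+_
  infix 4 _≈_ _≤_
  field
    Carrier : Set
    _≈_ : Carrier → Carrier → Set
    _+_ _*_ : Carrier → Carrier → Carrier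
    -_ : Carrier → Carrier
    0# 1# : Carrier
    isCommutativeRing : IsCommutativeRing _≈_ _+_ _*_ -_ 0# 1#
    _≤_ : Carrier → Carrier → Set
    isTotalOrder : IsTotalOrder _≈_ _≤_
    +-mono : ∀ {x y} z → x ≤ y → x + z ≤ y + z
    *-nonneg : ∀ {x y} → 0# ≤ x → 0# ≤ y → 0# ≤ x * y
    0≉1 : ¬ (0# ≈ 1#)
    inverse : ∀ x → ¬ (x ≈ 0#) → ∃[ y ] (x * y ≈ 1#)

  infix 4 _<_
  _<_ : Carrier → Carrier → Set
  x < y = (x ≤ y) × ¬ (x ≈ y)

  _^_ : Carrier → ℕ → Carrier
  x ^ zero = 1#
  x ^ suc n = x * (x ^ n)

module _ (F : OrderedField) where
  open OrderedField F

  record IsMetric (n : ℕ) (d : Fin n → Fin n → Carrier) : Set where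
    field
      nonneg : ∀ x y → 0# ≤ d x y
      zero-iff : ∀ x y → (d x y ≈ 0# → x ≡ y) × (x ≡ y → d x y ≈ 0#)
      sym : ∀ x y → d x y ≈ d y x
      triangle : ∀ x y z → d x z ≤ d x y + d y z

  IsMaxDist : (n : ℕ) → (Fin n → Fin n → Carrier) → Carrier → Set
  IsMaxDist n d m =
    (Σ (Fin n) λ x → Σ (Fin n) λ y → x ≢ y × d x y ≈ m)
    × (∀ x y → x ≢ y → d x y ≤ m)

  IsMinDist : (n : ℕ) → (Fin n → Fin n → Carrier) → Carrier → Set
  IsMinDist n d m =
    (Σ (Fin n) λ x → Σ (Fin n) λ y → x ≢ y × d x y ≈ m)
    × (∀ x y → x ≢ y → m ≤ d x y)

  -- Partitions of Fin n, represented by a cluster-labelling function: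
  -- x and y lie in the same cluster (P(x) = P(y)) iff  c x ≡ c y.

  Partition : ℕ → Set
  Partition n = Fin n → Fin n

  -- P is Δ-bounded, with Δ = dmax / μ^i  (denominator cleared: μ^i > 0)
  IsBoundedAt : (n : ℕ) → (Fin n → Fin n → Carrier) →
                (dmax μ : Carrier) → ℕ → Partition n → Set
  IsBoundedAt n d dmax μ i P =
    ∀ x y → P x ≡ P y → (μ ^ i) * d x y ≤ dmax

  Refines : (n : ℕ) → Partition n → Partition n → Set
  Refines n Q P = ∀ x y → Q x ≡ Q y → P x ≡ P y

  record HierarchicalPartition (n : ℕ) (d : Fin n → Fin n → Carrier)
           (dmax μ : Carrier) (B : ℕ) : Set where
    field
      part : ℕ → Partition n   -- only indices 0 … B are relevant
      bounded : ∀ i → i ≤ℕ B → IsBoundedAt n d dmax μ i (part i)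
      refines : ∀ i → i <ℕ B → Refines n (part (suc i)) (part i)

  open HierarchicalPartition public

  IsHPFamily : (n : ℕ) (d : Fin n → Fin n → Carrier) (dmax η μ : Carrier)
               (B k : ℕ) → (Fin k → HierarchicalPartition n d dmax μ B) → Set
  IsHPFamily n d dmax η μ B k H =
    ∀ (x : Fin n) (i : ℕ) → i ≤ℕ B →
      ∃[ j ] (∀ y → (μ ^ i) * d x y ≤ η * dmax → part (H j) i y ≡ part (H j) i x)
      -- B(x, η Δ_i) ⊆ P_i^{(j)}(x), denominator μ^i cleared

  -- A tree on vertices Fin m is given in rooted form: each non-root
  -- vertex v has a parent, joined to v by an edge of weight wt v ≥ 0;
  -- a rank function strictly decreasing towards the parent excludes
  -- cycles, and there is exactly one root, so the graph is a tree.

  record WeightedTree (n : ℕ) : Set where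
    field
      m : ℕ
      emb : Fin n → Fin m
      emb-inj : ∀ x y → emb x ≡ emb y → x ≡ y
      parent : Fin m → Maybe (Fin m)
      wt : Fin m → Carrier
      wt-nonneg : ∀ v → 0# ≤ wt v
      rank : Fin m → ℕ
      rank-dec : ∀ v p → parent v ≡ just p → rank p <ℕ rank v
      root : Fin m
      root-root : parent root ≡ nothing
      root-unique : ∀ v → parent v ≡ nothing → v ≡ root

  module _ {n : ℕ} (T : WeightedTree n) where
    open WeightedTree T

    data Walk : Fin m → Fin m → Set where
      here : ∀ {u} → Walk u u
      up   : ∀ {u p v} → parent u ≡ just p → Walk p v → Walk u v
      down : ∀ {u c v} → parent c ≡ just u → Walk c v → Walk u v

    walkLength : ∀ {u v} → Walk u v → Carrier
    walkLength here = 0#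
    walkLength (up {u = u} _ w) = wt u + walkLength w
    walkLength (down {c = c} _ w) = wt c + walkLength w

  -- d_T(u,v) is the minimum length of a walk from u to v; we speak of it
  -- through walks:  d ≤ d_T  iff every walk is at least d, and
  -- d_T ≤ a  iff some walk has length ≤ a.

  IsDominating : (n : ℕ) → (Fin n → Fin n → Carrier) → WeightedTree n → Set
  IsDominating n d T =
    ∀ x y (w : Walk T (WeightedTree.emb T x) (WeightedTree.emb T y)) →
      d x y ≤ walkLength T w

  -- Tree cover of size k and distortion μ/η (i.e. η · d_T ≤ μ · d for
  -- some tree, denominator η > 0 cleared)
  IsTreeCover : (n : ℕ) (d : Fin n → Fin n → Carrier) (η μ : Carrier)
                (k : ℕ) → (Fin k → WeightedTree n) → Set
  IsTreeCover n d η μ k T =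
    (∀ i → IsDominating n d (T i)) ×
    (∀ x y → x ≢ y →
      ∃[ i ] Σ (Walk (T i) (WeightedTree.emb (T i) x) (WeightedTree.emb (T i) y))
                (λ w → η * walkLength (T i) w ≤ μ * d x y))

-- Each hierarchical partition H gives a tree: below a root, one vertex for every cluster of
-- P₁, …, P_B, and the points as leaves, each vertex hanging from the cluster of the previous
-- level that contains it.  Edge weights are chosen so that a level-L vertex lies at height Δ_L / 2
-- above the leaves; hence two points sharing a level-i cluster are joined by a walk of length
-- Δ_i.  Conversely, if x and y first separate at level i + 1, a potential that is Δ_i at y, 0 at
-- x and 1-Lipschitz along edges shows every walk between them is at least Δ_i ≥ d(x, y), so
-- every tree dominates.  For x ≠ y let i be the last scale with μ^i d(x, y) ≤ η dmax: some H^j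
-- keeps B(x, η Δ_i) inside one level-i cluster, and there the walk has length
-- Δ_i ≤ (μ / η) d(x, y) by maximality of i.

module Submission where

open import Defs
open import Level using (0ℓ)
open import Data.Nat using (ℕ; zero; suc; _∸_; z≤n; s≤s; _≤′_; ≤′-refl; ≤′-step)
  renaming (_+_ to _ℕ+_; _*_ to _ℕ*_; _≤_ to _≤ℕ_; _<_ to _<ℕ_; _≤?_ to _≤ℕ?_)
import Data.Nat.Properties as ℕP
import Data.Fin as Fin
open import Data.Fin using (Fin; toℕ; fromℕ<; combine; remQuot)
import Data.Fin.Properties as FinP
import Data.Maybe
open import Data.Maybe using (Maybe; just; nothing)
import Data.Maybe.Properties as MaybeP
open import Data.Empty using (⊥-elim)
open import Data.Unit using (⊤; tt)
open import Data.Sum using (_⊎_; inj₁; inj₂)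
open import Data.Product using (Σ; ∃-syntax; _×_; _,_; proj₁; proj₂; uncurry)
open import Function using (_∘_)
open import Relation.Nullary using (¬_; Dec; yes; no; recompute)
open import Relation.Nullary.Decidable using (_×-dec_; toSum)
open import Relation.Binary.Definitions using (DecidableEquality)
open import Relation.Binary.PropositionalEquality using (_≡_; _≢_; refl; sym; trans; cong; subst)
open import Relation.Binary.Structures using (IsTotalOrder)
open import Algebra.Bundles using (CommutativeRing)
import Algebra.Properties.Ring as RingProperties
import Relation.Binary.Reasoning.Setoid as SetoidReasoning
import Relation.Binary.Reasoning.PartialOrder as PosetReasoning
open import Relation.Binary.Bundles using (Poset)

module OrderedFieldProperties (F : OrderedField) where
  open OrderedField F

  commutativeRing : CommutativeRing 0ℓ 0ℓ
  commutativeRing = record { isCommutativeRing = isCommutativeRing }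

  open CommutativeRing commutativeRing public
    using ( setoid; +-cong; +-congˡ; +-congʳ; *-congˡ; *-congʳ; +-assoc; +-comm; *-assoc; *-comm
          ; +-identityˡ; +-identityʳ; *-identityˡ; *-identityʳ; -‿inverseˡ; -‿inverseʳ; -‿cong
          ; distribˡ; distribʳ; zeroʳ )
    renaming (refl to ≈-refl; sym to ≈-sym; trans to ≈-trans; reflexive to ≈-reflexive)
  open RingProperties (CommutativeRing.ring commutativeRing) public
    using (-‿involutive; -‿distribˡ-*; -‿distribʳ-*; -0#≈0#)
  open IsTotalOrder isTotalOrder public
    using () renaming (reflexive to ≤-reflexive; trans to ≤-trans; antisym to ≤-antisym; total to ≤-total)
  module ≈-Reasoning = SetoidReasoning setoid

  poset : Poset 0ℓ 0ℓ 0ℓ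
  poset = record { isPartialOrder = IsTotalOrder.isPartialOrder isTotalOrder }

  module ≤-Reasoning = PosetReasoning poset

  infixl 6 _-_
  _-_ : Carrier → Carrier → Carrier
  x - y = x + - y

  [x-y]+y≈x : ∀ x y → (x - y) + y ≈ x
  [x-y]+y≈x x y = ≈-trans (+-assoc x (- y) y) (≈-trans (+-congˡ (-‿inverseˡ y)) (+-identityʳ x))

  y+[x-y]≈x : ∀ x y → y + (x - y) ≈ x
  y+[x-y]≈x x y = ≈-trans (+-comm y (x - y)) ([x-y]+y≈x x y)

  [x-y]+[y-z]≈x-z : ∀ x y z → (x - y) + (y - z) ≈ x - z
  [x-y]+[y-z]≈x-z x y z = begin
    (x - y) + (y - z)  ≈⟨ +-assoc x (- y) (y - z) ⟩
    x + (- y + (y - z)) ≈⟨ +-congˡ (≈-sym (+-assoc (- y) y (- z))) ⟩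
    x + ((- y + y) - z) ≈⟨ +-congˡ (+-congʳ (-‿inverseˡ y)) ⟩
    x + (0# - z)        ≈⟨ +-congˡ (+-identityˡ (- z)) ⟩
    x - z               ∎
    where open ≈-Reasoning

  x*[y*z]≈y*[x*z] : ∀ x y z → x * (y * z) ≈ y * (x * z)
  x*[y*z]≈y*[x*z] x y z =
    ≈-trans (≈-sym (*-assoc x y z)) (≈-trans (*-congʳ (*-comm x y)) (*-assoc y x z))

  x+[[y+y]+x]≈[y+x]+[y+x] : ∀ x y → x + ((y + y) + x) ≈ (y + x) + (y + x)
  x+[[y+y]+x]≈[y+x]+[y+x] x y = begin
    x + ((y + y) + x)   ≈⟨ +-congˡ (+-assoc y y x) ⟩
    x + (y + (y + x))   ≈⟨ ≈-sym (+-assoc x y (y + x)) ⟩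
    (x + y) + (y + x)   ≈⟨ +-congʳ (+-comm x y) ⟩
    (y + x) + (y + x)   ∎
    where open ≈-Reasoning

  x-0≈x : ∀ x → x - 0# ≈ x
  x-0≈x x = ≈-trans (+-congˡ -0#≈0#) (+-identityʳ x)

  ≤-refl : ∀ {x} → x ≤ x
  ≤-refl = ≤-reflexive ≈-refl

  ≤-respˡʳ-≈ : ∀ {x x′ y y′} → x ≈ x′ → y ≈ y′ → x ≤ y → x′ ≤ y′
  ≤-respˡʳ-≈ x≈x′ y≈y′ x≤y = ≤-trans (≤-reflexive (≈-sym x≈x′)) (≤-trans x≤y (≤-reflexive y≈y′))

  +-monoʳ-≤ : ∀ z {x y} → x ≤ y → z + x ≤ z + y
  +-monoʳ-≤ z {x} {y} x≤y = ≤-respˡʳ-≈ (+-comm x z) (+-comm y z) (+-mono z x≤y)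

  x≤y⇒0≤y-x : ∀ {x y} → x ≤ y → 0# ≤ y - x
  x≤y⇒0≤y-x {x} x≤y = ≤-respˡʳ-≈ (-‿inverseʳ x) ≈-refl (+-mono (- x) x≤y)

  0≤y-x⇒x≤y : ∀ {x y} → 0# ≤ y - x → x ≤ y
  0≤y-x⇒x≤y {x} {y} p = ≤-respˡʳ-≈ (+-identityˡ x) ([x-y]+y≈x y x) (+-mono x p)

  infix 4 ∣_-_∣≤_
  ∣_-_∣≤_ : Carrier → Carrier → Carrier → Set
  ∣ x - y ∣≤ w = (x ≤ y + w) × (y ≤ x + w)

  x≤x+y : ∀ {x y} → 0# ≤ y → x ≤ x + y
  x≤x+y {x} 0≤y = ≤-respˡʳ-≈ (+-identityʳ x) ≈-refl (+-monoʳ-≤ x 0≤y)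

  neg-antimono-≤ : ∀ {x y} → x ≤ y → - y ≤ - x
  neg-antimono-≤ {x} {y} x≤y = ≤-respˡʳ-≈ (+-identityˡ (- y)) eq (+-mono (- y) (x≤y⇒0≤y-x x≤y))
    where
    eq : (y - x) - y ≈ - x
    eq = begin
      (y - x) - y     ≈⟨ +-comm (y - x) (- y) ⟩
      - y + (y - x)   ≈⟨ ≈-sym (+-assoc (- y) y (- x)) ⟩
      (- y + y) - x   ≈⟨ +-congʳ (-‿inverseˡ y) ⟩
      0# - x          ≈⟨ +-identityˡ (- x) ⟩
      - x             ∎
      where open ≈-Reasoning

  y≤x⇒∣x-y∣≤x-y : ∀ {x y} → y ≤ x → ∣ x - y ∣≤ x - y
  y≤x⇒∣x-y∣≤x-y {x} {y} y≤x =
    ≤-reflexive (≈-sym (y+[x-y]≈x x y)) , ≤-trans y≤x (x≤x+y (x≤y⇒0≤y-x y≤x))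

  y≤x⇒∣[z-x]-[z-y]∣≤x-y : ∀ {x y} z → y ≤ x → ∣ (z - x) - (z - y) ∣≤ x - y
  y≤x⇒∣[z-x]-[z-y]∣≤x-y {x} {y} z y≤x =
    ≤-trans (+-monoʳ-≤ z (neg-antimono-≤ y≤x)) (x≤x+y (x≤y⇒0≤y-x y≤x)) ,
    ≤-reflexive (≈-sym ([x-y]+[y-z]≈x-z z x y))

  y≤x⇒∣x-[[x+x]-y]∣≤x-y : ∀ {x y} → y ≤ x → ∣ x - ((x + x) - y) ∣≤ x - y
  y≤x⇒∣x-[[x+x]-y]∣≤x-y {x} {y} y≤x =
    ≤-trans (x≤x+y 0≤x-y) (≤-respˡʳ-≈ ≈-refl (+-congʳ (≈-sym (+-assoc x x (- y)))) (x≤x+y 0≤x-y)) ,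
    ≤-reflexive (+-assoc x x (- y))
    where
    0≤x-y : 0# ≤ x - y
    0≤x-y = x≤y⇒0≤y-x y≤x

  *-monoˡ-≤ : ∀ {z x y} → 0# ≤ z → x ≤ y → z * x ≤ z * y
  *-monoˡ-≤ {z} {x} {y} 0≤z x≤y =
    0≤y-x⇒x≤y (≤-respˡʳ-≈ ≈-refl distrib (*-nonneg 0≤z (x≤y⇒0≤y-x x≤y)))
    where
    distrib : z * (y - x) ≈ z * y - z * x
    distrib = ≈-trans (distribˡ z y (- x)) (+-congˡ (≈-sym (-‿distribʳ-* z x)))

  *-monoʳ-≤ : ∀ {z x y} → 0# ≤ z → x ≤ y → x * z ≤ y * z
  *-monoʳ-≤ {z} {x} {y} 0≤z x≤y = ≤-respˡʳ-≈ (*-comm z x) (*-comm z y) (*-monoˡ-≤ 0≤z x≤y)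

  0≤1 : 0# ≤ 1#
  0≤1 with ≤-total 0# 1#
  ... | inj₁ 0≤1 = 0≤1
  ... | inj₂ 1≤0 = ≤-respˡʳ-≈ ≈-refl [-1]*[-1]≈1 (*-nonneg 0≤-1 0≤-1)
    where
    0≤-1 : 0# ≤ - 1#
    0≤-1 = ≤-respˡʳ-≈ (-‿inverseʳ 1#) (+-identityˡ (- 1#)) (+-mono (- 1#) 1≤0)
    [-1]*[-1]≈1 : - 1# * - 1# ≈ 1#
    [-1]*[-1]≈1 = ≈-trans (≈-sym (-‿distribˡ-* 1# (- 1#)))
                    (≈-trans (-‿cong (*-identityˡ (- 1#))) (-‿involutive 1#))

  1≰0 : ¬ (1# ≤ 0#)
  1≰0 1≤0 = 0≉1 (≤-antisym 0≤1 1≤0)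

  *-cancelˡ-≈ : ∀ {z x y} → ¬ (z ≈ 0#) → z * x ≈ z * y → x ≈ y
  *-cancelˡ-≈ {z} {x} {y} z≉0 zx≈zy with inverse z z≉0
  ... | z⁻¹ , zz⁻¹≈1 = begin
    x              ≈⟨ ≈-sym (*-identityˡ x) ⟩
    1# * x         ≈⟨ *-congʳ (≈-sym (≈-trans (*-comm z⁻¹ z) zz⁻¹≈1)) ⟩
    (z⁻¹ * z) * x  ≈⟨ *-assoc z⁻¹ z x ⟩
    z⁻¹ * (z * x)  ≈⟨ *-congˡ zx≈zy ⟩
    z⁻¹ * (z * y)  ≈⟨ ≈-sym (*-assoc z⁻¹ z y) ⟩
    (z⁻¹ * z) * y  ≈⟨ *-congʳ (≈-trans (*-comm z⁻¹ z) zz⁻¹≈1) ⟩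
    1# * y         ≈⟨ *-identityˡ y ⟩
    y              ∎
    where open ≈-Reasoning

  *-cancelˡ-≤ : ∀ {z x y} → 0# ≤ z → ¬ (z ≈ 0#) → z * x ≤ z * y → x ≤ y
  *-cancelˡ-≤ {z} {x} {y} 0≤z z≉0 zx≤zy with ≤-total x y
  ... | inj₁ x≤y = x≤y
  ... | inj₂ y≤x = ≤-reflexive (*-cancelˡ-≈ z≉0 (≤-antisym zx≤zy (*-monoˡ-≤ 0≤z y≤x)))

  0≤1+1 : 0# ≤ 1# + 1#
  0≤1+1 = ≤-trans 0≤1 (x≤x+y 0≤1)

  1+1≉0 : ¬ (1# + 1# ≈ 0#)
  1+1≉0 1+1≈0 = 1≰0 (≤-respˡʳ-≈ ≈-refl 1+1≈0 (x≤x+y 0≤1))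

  half : Carrier
  half = proj₁ (inverse (1# + 1#) 1+1≉0)

  [1+1]*half≈1 : (1# + 1#) * half ≈ 1#
  [1+1]*half≈1 = proj₂ (inverse (1# + 1#) 1+1≉0)

  0≤half : 0# ≤ half
  0≤half with ≤-total 0# half
  ... | inj₁ 0≤half = 0≤half
  ... | inj₂ half≤0 =
    ⊥-elim (1≰0 (≤-respˡʳ-≈ [1+1]*half≈1 (zeroʳ (1# + 1#)) (*-monoˡ-≤ 0≤1+1 half≤0)))

  half+half≈1 : half + half ≈ 1#
  half+half≈1 = begin
    half + half            ≈⟨ +-cong (≈-sym (*-identityˡ half)) (≈-sym (*-identityˡ half)) ⟩
    1# * half + 1# * half  ≈⟨ ≈-sym (distribʳ half 1# 1#) ⟩
    (1# + 1#) * half       ≈⟨ [1+1]*half≈1 ⟩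
    1#                     ∎
    where open ≈-Reasoning

  x*half+x*half≈x : ∀ x → x * half + x * half ≈ x
  x*half+x*half≈x x =
    ≈-trans (≈-sym (distribˡ x half half)) (≈-trans (*-congˡ half+half≈1) (*-identityʳ x))

  x*y≉0 : ∀ {x y} → ¬ (x ≈ 0#) → ¬ (y ≈ 0#) → ¬ (x * y ≈ 0#)
  x*y≉0 {x} x≉0 y≉0 xy≈0 = y≉0 (*-cancelˡ-≈ x≉0 (≈-trans xy≈0 (≈-sym (zeroʳ x))))

  ^-nonNeg : ∀ {x} → 0# ≤ x → ∀ k → 0# ≤ x ^ k
  ^-nonNeg 0≤x zero = 0≤1
  ^-nonNeg 0≤x (suc k) = *-nonneg 0≤x (^-nonNeg 0≤x k)

  ^-≉0 : ∀ {x} → ¬ (x ≈ 0#) → ∀ k → ¬ (x ^ k ≈ 0#)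
  ^-≉0 x≉0 zero 1≈0 = 0≉1 (≈-sym 1≈0)
  ^-≉0 x≉0 (suc k) = x*y≉0 x≉0 (^-≉0 x≉0 k)

  ^-distribˡ-+-* : ∀ x i j → x ^ (i ℕ+ j) ≈ (x ^ i) * (x ^ j)
  ^-distribˡ-+-* x zero j = ≈-sym (*-identityˡ (x ^ j))
  ^-distribˡ-+-* x (suc i) j =
    ≈-trans (*-congˡ (^-distribˡ-+-* x i j)) (≈-sym (*-assoc x (x ^ i) (x ^ j)))

module WalkProperties (F : OrderedField) {n : ℕ} (T : WeightedTree F n) where
  open OrderedField F
  open OrderedFieldProperties F
  open WeightedTree T

  EdgeLipschitz : (Fin m → Carrier) → Set
  EdgeLipschitz f = ∀ v p → parent v ≡ just p → ∣ f p - f v ∣≤ wt v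

  walkLength-nonNeg : ∀ {u v} (w : Walk F T u v) → 0# ≤ walkLength F T w
  walkLength-nonNeg here = ≤-refl
  walkLength-nonNeg (up {u} _ w) = ≤-trans (wt-nonneg u) (x≤x+y (walkLength-nonNeg w))
  walkLength-nonNeg (down {c = c} _ w) = ≤-trans (wt-nonneg c) (x≤x+y (walkLength-nonNeg w))

  EdgeLipschitz⇒≤walkLength : ∀ f → EdgeLipschitz f →
                              ∀ {u v} (w : Walk F T u v) → f v ≤ f u + walkLength F T w
  EdgeLipschitz⇒≤walkLength f lip here = ≤-reflexive (≈-sym (+-identityʳ _))
  EdgeLipschitz⇒≤walkLength f lip (up {u} {p} e w) =
    ≤-trans (EdgeLipschitz⇒≤walkLength f lip w)
            (≤-respˡʳ-≈ ≈-refl (+-assoc (f u) (wt u) _) (+-mono _ (proj₁ (lip u p e))))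
  EdgeLipschitz⇒≤walkLength f lip (down {u} {c} e w) =
    ≤-trans (EdgeLipschitz⇒≤walkLength f lip w)
            (≤-respˡʳ-≈ ≈-refl (+-assoc (f u) (wt c) _) (+-mono _ (proj₂ (lip c u e))))

  snocDown : ∀ {u v c} → Walk F T u v → parent c ≡ just v → Walk F T u c
  snocDown here e = down e here
  snocDown (up e′ w) e = up e′ (snocDown w e)
  snocDown (down e′ w) e = down e′ (snocDown w e)

  walkLength-snocDown : ∀ {u v c} (w : Walk F T u v) (e : parent c ≡ just v) →
                        walkLength F T (snocDown w e) ≈ walkLength F T w + wt c
  walkLength-snocDown here e = ≈-trans (+-identityʳ _) (≈-sym (+-identityˡ _))
  walkLength-snocDown (up e′ w) e =
    ≈-trans (+-congˡ (walkLength-snocDown w e)) (≈-sym (+-assoc _ _ _))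
  walkLength-snocDown (down e′ w) e =
    ≈-trans (+-congˡ (walkLength-snocDown w e)) (≈-sym (+-assoc _ _ _))

lastCrossing : ∀ {P R : ℕ → Set} B → (∀ i → P (suc i) ⊎ R i) → R B → P 0 →
               ∃[ i ] i ≤ℕ B × P i × R i
lastCrossing zero step r p₀ = 0 , z≤n , p₀ , r
lastCrossing (suc B) step r p₀ with step 0
... | inj₂ r₀ = 0 , z≤n , p₀ , r₀
... | inj₁ p₁ with lastCrossing B (step ∘ suc) r p₁
...   | i , i≤B , pᵢ , rᵢ = suc i , s≤s i≤B , pᵢ , rᵢ

module _ {n : ℕ} {A : Set} (_≟_ : DecidableEquality A) (f : Fin n → A) where
  private
    pick : (c : A) → ∃[ w ] f w ≡ c → Fin n
    pick c hit with FinP.any? (λ w → f w ≟ c)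
    ... | yes (w , _) = w
    ... | no none = ⊥-elim (none hit)

    pick-member : ∀ c hit → f (pick c hit) ≡ c
    pick-member c hit with FinP.any? (λ w → f w ≟ c)
    ... | yes (_ , fw≡c) = fw≡c
    ... | no none = ⊥-elim (none hit)

    pick-cong : ∀ {c c′} hit hit′ → c ≡ c′ → pick c hit ≡ pick c′ hit′
    pick-cong {c} hit hit′ refl with FinP.any? (λ w → f w ≟ c)
    ... | yes _ = refl
    ... | no none = ⊥-elim (none hit)

  canonical : Fin n → Fin n
  canonical z = pick (f z) (z , refl)

  canonical-member : ∀ z → f (canonical z) ≡ f z
  canonical-member z = pick-member (f z) (z , refl)

  canonical-cong : ∀ {x y} → f x ≡ f y → canonical x ≡ canonical y
  canonical-cong {x} {y} = pick-cong (x , refl) (y , refl)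

module Scales (F : OrderedField) (B : ℕ) {μ η dmax dmin : OrderedField.Carrier F}
  (1≤μ : OrderedField._≤_ F (OrderedField.1# F) μ) (η≤1 : OrderedField._≤_ F η (OrderedField.1# F))
  (0≤dmin : OrderedField._≤_ F (OrderedField.0# F) dmin)
  (dmax≈μ^B*dmin : OrderedField._≈_ F dmax (OrderedField._*_ F (OrderedField._^_ F μ B) dmin))
  where
  open OrderedField F
  open OrderedFieldProperties F

  0≤μ : 0# ≤ μ
  0≤μ = ≤-trans 0≤1 1≤μ

  μ≉0 : ¬ (μ ≈ 0#)
  μ≉0 μ≈0 = 1≰0 (≤-respˡʳ-≈ ≈-refl μ≈0 1≤μ)

  x≤μ*x : ∀ {x} → 0# ≤ x → x ≤ μ * x
  x≤μ*x {x} 0≤x = ≤-respˡʳ-≈ (*-identityˡ x) ≈-refl (*-monoʳ-≤ 0≤x 1≤μ)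

  -- The tree distance between leaves meeting at level i is Δ i = 2 · height i = dmax / μ^i.
  heightAbove : ℕ → Carrier
  heightAbove zero = 0#
  heightAbove (suc k) = (μ ^ k) * dmin * half

  height : ℕ → Carrier
  height L = heightAbove (suc B ∸ L)

  Δ : ℕ → Carrier
  Δ i = height i + height i

  heightAbove-mono : ∀ k → heightAbove k ≤ heightAbove (suc k)
  heightAbove-mono zero = *-nonneg (*-nonneg 0≤1 0≤dmin) 0≤half
  heightAbove-mono (suc k) = ≤-respˡʳ-≈ ≈-refl reassoc
    (x≤μ*x (*-nonneg (*-nonneg (^-nonNeg 0≤μ k) 0≤dmin) 0≤half))
    where
    reassoc : μ * ((μ ^ k) * dmin * half) ≈ μ * (μ ^ k) * dmin * half
    reassoc = ≈-trans (≈-sym (*-assoc μ _ half)) (*-congʳ (≈-sym (*-assoc μ (μ ^ k) dmin)))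

  height-antimono : ∀ {L} → L ≤ℕ B → height (suc L) ≤ height L
  height-antimono {L} L≤B rewrite ℕP.+-∸-assoc 1 L≤B = heightAbove-mono (B ∸ L)

  height-leaf : height (suc B) ≈ 0#
  height-leaf rewrite ℕP.n∸n≡0 B = ≈-refl

  Δi≈μ^[B-i]*dmin : ∀ {i} → i ≤ℕ B → Δ i ≈ (μ ^ (B ∸ i)) * dmin
  Δi≈μ^[B-i]*dmin {i} i≤B rewrite ℕP.+-∸-assoc 1 i≤B = x*half+x*half≈x _

  μ^i*Δi≈dmax : ∀ {i} → i ≤ℕ B → (μ ^ i) * Δ i ≈ dmax
  μ^i*Δi≈dmax {i} i≤B = begin
    (μ ^ i) * Δ i                  ≈⟨ *-congˡ (Δi≈μ^[B-i]*dmin i≤B) ⟩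
    (μ ^ i) * ((μ ^ (B ∸ i)) * dmin) ≈⟨ ≈-sym (*-assoc (μ ^ i) _ dmin) ⟩
    (μ ^ i) * (μ ^ (B ∸ i)) * dmin ≈⟨ *-congʳ (≈-sym (^-distribˡ-+-* μ i (B ∸ i))) ⟩
    (μ ^ (i ℕ+ (B ∸ i))) * dmin    ≡⟨ cong (λ k → (μ ^ k) * dmin) (ℕP.m+[n∸m]≡n i≤B) ⟩
    (μ ^ B) * dmin                 ≈⟨ ≈-sym dmax≈μ^B*dmin ⟩
    dmax                           ∎
    where open ≈-Reasoning

  μ^i*δ≤dmax⇒δ≤Δi : ∀ {i δ} → i ≤ℕ B → (μ ^ i) * δ ≤ dmax → δ ≤ Δ i
  μ^i*δ≤dmax⇒δ≤Δi {i} i≤B le =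
    *-cancelˡ-≤ (^-nonNeg 0≤μ i) (^-≉0 μ≉0 i) (≤-respˡʳ-≈ ≈-refl (≈-sym (μ^i*Δi≈dmax i≤B)) le)

  η*Δi≤μ*δ : ∀ {i δ} → i ≤ℕ B → η * dmax ≤ (μ ^ suc i) * δ → η * Δ i ≤ μ * δ
  η*Δi≤μ*δ {i} {δ} i≤B le = *-cancelˡ-≤ (^-nonNeg 0≤μ i) (^-≉0 μ≉0 i) (begin
    (μ ^ i) * (η * Δ i)  ≈⟨ x*[y*z]≈y*[x*z] (μ ^ i) η (Δ i) ⟩
    η * ((μ ^ i) * Δ i)  ≈⟨ *-congˡ (μ^i*Δi≈dmax i≤B) ⟩
    η * dmax             ≤⟨ le ⟩
    μ * (μ ^ i) * δ      ≈⟨ ≈-trans (*-congʳ (*-comm μ (μ ^ i))) (*-assoc (μ ^ i) μ δ) ⟩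
    (μ ^ i) * (μ * δ)    ∎)
    where open ≤-Reasoning

  η*dmax≤μ^[1+B]*δ : ∀ {δ} → dmin ≤ δ → η * dmax ≤ (μ ^ suc B) * δ
  η*dmax≤μ^[1+B]*δ {δ} dmin≤δ = begin
    η * dmax            ≤⟨ *-monoʳ-≤ 0≤dmax η≤1 ⟩
    1# * dmax           ≈⟨ ≈-trans (*-identityˡ dmax) dmax≈μ^B*dmin ⟩
    (μ ^ B) * dmin      ≤⟨ *-monoˡ-≤ (^-nonNeg 0≤μ B) dmin≤δ ⟩
    (μ ^ B) * δ         ≤⟨ x≤μ*x (*-nonneg (^-nonNeg 0≤μ B) (≤-trans 0≤dmin dmin≤δ)) ⟩
    μ * ((μ ^ B) * δ)   ≈⟨ ≈-sym (*-assoc μ (μ ^ B) δ) ⟩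
    (μ ^ suc B) * δ     ∎
    where
    open ≤-Reasoning
    0≤dmax : 0# ≤ dmax
    0≤dmax = ≤-respˡʳ-≈ ≈-refl (≈-sym dmax≈μ^B*dmin) (*-nonneg (^-nonNeg 0≤μ B) 0≤dmin)

module Construction (F : OrderedField) {n : ℕ} {d : Fin n → Fin n → OrderedField.Carrier F}
  (metric : IsMetric F n d) {dmax dmin : OrderedField.Carrier F}
  (isMax : IsMaxDist F n d dmax) (isMin : IsMinDist F n d dmin)
  {η μ : OrderedField.Carrier F}
  (η<1 : OrderedField._<_ F η (OrderedField.1# F)) (1<μ : OrderedField._<_ F (OrderedField.1# F) μ)
  (B : ℕ) (dmax≈μ^B*dmin : OrderedField._≈_ F dmax (OrderedField._*_ F (OrderedField._^_ F μ B) dmin))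
  where
  open OrderedField F
  open OrderedFieldProperties F

  0≤dmin : 0# ≤ dmin
  0≤dmin with proj₁ isMin
  ... | x , y , _ , dxy≈dmin = ≤-respˡʳ-≈ ≈-refl dxy≈dmin (IsMetric.nonneg metric x y)

  open Scales F B (proj₁ 1<μ) (proj₁ η<1) 0≤dmin dmax≈μ^B*dmin

  -- At scale 0 no ball condition is needed: the root joins all leaves.
  InBallAtScale : ℕ → Fin n → Fin n → Set
  InBallAtScale zero _ _ = ⊤
  InBallAtScale (suc i) x y = (μ ^ suc i) * d x y ≤ η * dmax

  separationScale : ∀ {x y} → x ≢ y →
    ∃[ i ] i ≤ℕ B × InBallAtScale i x y × η * dmax ≤ (μ ^ suc i) * d x y
  separationScale {x} {y} x≢y =
    lastCrossing B (λ i → ≤-total ((μ ^ suc i) * d x y) (η * dmax))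
                   (η*dmax≤μ^[1+B]*δ (proj₂ isMin x y x≢y)) tt

  module HierarchyTree (H : HierarchicalPartition F n d dmax μ B) where

    -- Level 0 is the single cluster X,
    -- levels 1 … B are the clusters of P₁ … P_B and level B + 1 consists of singletons.
    cluster : ℕ → Fin n → Maybe (Fin n)
    cluster zero _ = nothing
    cluster (suc L) z with suc L ≤ℕ? B
    ... | yes _ = just (part H (suc L) z)
    ... | no _ = just z

    cluster-part : ∀ {L} z → suc L ≤ℕ B → cluster (suc L) z ≡ just (part H (suc L) z)
    cluster-part {L} z L<B with suc L ≤ℕ? B
    ... | yes _ = refl
    ... | no L≮B = ⊥-elim (L≮B L<B)

    cluster-above : ∀ {L} z → ¬ (suc L ≤ℕ B) → cluster (suc L) z ≡ just z
    cluster-above {L} z L≮B with suc L ≤ℕ? B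
    ... | yes L<B = ⊥-elim (L≮B L<B)
    ... | no _ = refl

    cluster≡⇒part≡ : ∀ {L x y} → suc L ≤ℕ B →
                     cluster (suc L) x ≡ cluster (suc L) y → part H (suc L) x ≡ part H (suc L) y
    cluster≡⇒part≡ {x = x} {y} L<B e =
      MaybeP.just-injective (trans (sym (cluster-part x L<B)) (trans e (cluster-part y L<B)))

    part≡⇒cluster≡ : ∀ {L x y} → suc L ≤ℕ B →
                     part H (suc L) x ≡ part H (suc L) y → cluster (suc L) x ≡ cluster (suc L) y
    part≡⇒cluster≡ {x = x} {y} L<B e =
      trans (cluster-part x L<B) (trans (cong just e) (sym (cluster-part y L<B)))

    cluster-leaf-injective : ∀ {x y} → cluster (suc B) x ≡ cluster (suc B) y → x ≡ y
    cluster-leaf-injective {x} {y} e = MaybeP.just-injective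
      (trans (sym (cluster-above x (ℕP.n≮n B))) (trans e (cluster-above y (ℕP.n≮n B))))

    cluster-refines-suc : ∀ {L x y} → L ≤ℕ B →
                          cluster (suc L) x ≡ cluster (suc L) y → cluster L x ≡ cluster L y
    cluster-refines-suc {zero} _ _ = refl
    cluster-refines-suc {suc L} {x} {y} L<B e = by-cases (suc (suc L) ≤ℕ? B)
      where
      by-cases : Dec (suc (suc L) ≤ℕ B) → cluster (suc L) x ≡ cluster (suc L) y
      by-cases (yes L+1<B) =
        part≡⇒cluster≡ L<B (refines H (suc L) L+1<B x y (cluster≡⇒part≡ L+1<B e))
      by-cases (no L+1≮B) = cong (cluster (suc L)) (MaybeP.just-injective
        (trans (sym (cluster-above x L+1≮B)) (trans e (cluster-above y L+1≮B))))

    cluster-refines : ∀ {a b x y} → b ≤′ a → a ≤ℕ suc B →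
                      cluster a x ≡ cluster a y → cluster b x ≡ cluster b y
    cluster-refines ≤′-refl _ e = e
    cluster-refines (≤′-step b≤′a) a<B+1 e =
      cluster-refines b≤′a (ℕP.m≤n⇒m≤1+n (ℕP.≤-pred a<B+1))
                           (cluster-refines-suc (ℕP.≤-pred a<B+1) e)

    representative : ℕ → Fin n → Fin n
    representative L = canonical (MaybeP.≡-dec FinP._≟_) (cluster L)

    cluster-representative : ∀ {i L} z → i ≤ℕ L → L ≤ℕ suc B →
                             cluster i (representative L z) ≡ cluster i z
    cluster-representative {L = L} z i≤L L≤B+1 = cluster-refines (ℕP.≤⇒≤′ i≤L) L≤B+1
      (canonical-member (MaybeP.≡-dec FinP._≟_) (cluster L) z)

    representative-preserves-cluster : ∀ {i L u v} → i ≤ℕ L → L ≤ℕ suc B →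
      cluster i u ≡ cluster i v → cluster i (representative L u) ≡ cluster i (representative L v)
    representative-preserves-cluster {u = u} {v} i≤L L≤B+1 e =
      trans (cluster-representative u i≤L L≤B+1) (trans e (sym (cluster-representative v i≤L L≤B+1)))

    -- node a _ z is the level-(1 + a) cluster of z; the leaves are node B _ z.  Every point
    -- labels a vertex at every level, but parents are labelled by canonical representatives,
    -- so clusters are merged correctly and the surplus vertices are harmless.
    data Vertex : Set where
      root : Vertex
      node : (a : ℕ) → .(a ≤ℕ B) → Fin n → Vertex

    node-cong : ∀ {a a′ z z′} .{p : a ≤ℕ B} .{p′ : a′ ≤ℕ B} →
                a ≡ a′ → z ≡ z′ → node a p z ≡ node a′ p′ z′
    node-cong refl refl = refl

    leaf : Fin n → Vertex
    leaf = node B ℕP.≤-refl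

    level : Vertex → ℕ
    level root = 0
    level (node a _ _) = suc a

    parentNode : (a : ℕ) → .(a ≤ℕ B) → Fin n → Vertex
    parentNode zero _ _ = root
    parentNode (suc a) a<B z = node a (ℕP.<⇒≤ a<B) (representative (suc a) z)

    parentOf : Vertex → Maybe Vertex
    parentOf root = nothing
    parentOf (node a a≤B z) = just (parentNode a a≤B z)

    level-parentNode : ∀ a .(a≤B : a ≤ℕ B) z → level (parentNode a a≤B z) <ℕ suc a
    level-parentNode zero _ _ = s≤s z≤n
    level-parentNode (suc a) _ _ = ℕP.n<1+n (suc a)

    parentNode-cong : ∀ a .(a≤B : a ≤ℕ B) {u v} → cluster a u ≡ cluster a v →
                      parentNode a a≤B u ≡ parentNode a a≤B v
    parentNode-cong zero _ _ = refl
    parentNode-cong (suc a) _ e =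
      cong (node a _) (canonical-cong (MaybeP.≡-dec FinP._≟_) (cluster (suc a)) e)

    weight : Vertex → Carrier
    weight root = 0#
    weight (node a _ _) = height a - height (suc a)

    weight-nonNeg : ∀ v → 0# ≤ weight v
    weight-nonNeg root = ≤-refl
    weight-nonNeg (node a a≤B _) = x≤y⇒0≤y-x (height-antimono (recompute (a ≤ℕ? B) a≤B))

    size : ℕ
    size = suc (suc B ℕ* n)

    toFin : Vertex → Fin size
    toFin root = Fin.zero
    toFin (node a a≤B z) = Fin.suc (combine (fromℕ< (s≤s a≤B)) z)

    nodeOf : Fin (suc B) × Fin n → Vertex
    nodeOf (a , z) = node (toℕ a) (FinP.toℕ≤pred[n] a) z

    fromFin : Fin size → Vertex
    fromFin Fin.zero = root
    fromFin (Fin.suc k) = nodeOf (remQuot {suc B} n k)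

    fromFin-toFin : ∀ v → fromFin (toFin v) ≡ v
    fromFin-toFin root = refl
    fromFin-toFin (node a a≤B z) =
      trans (cong nodeOf (FinP.remQuot-combine {suc B} {n} (fromℕ< (s≤s a≤B)) z))
            (node-cong (FinP.toℕ-fromℕ< (s≤s a≤B)) refl)

    toFin-nodeOf : ∀ (az : Fin (suc B) × Fin n) → toFin (nodeOf az) ≡ Fin.suc (uncurry combine az)
    toFin-nodeOf (a , z) = cong (λ q → Fin.suc (combine q z)) (FinP.fromℕ<-toℕ a _)

    toFin-fromFin : ∀ k → toFin (fromFin k) ≡ k
    toFin-fromFin Fin.zero = refl
    toFin-fromFin (Fin.suc k) =
      trans (toFin-nodeOf (remQuot {suc B} n k)) (cong Fin.suc (FinP.combine-remQuot {suc B} n k))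

    parent : Fin size → Maybe (Fin size)
    parent = Data.Maybe.map toFin ∘ parentOf ∘ fromFin

    parent-decreases-level : ∀ k p → parent k ≡ just p → level (fromFin p) <ℕ level (fromFin k)
    parent-decreases-level k p e with fromFin k | e
    ... | node a a≤B z | refl rewrite fromFin-toFin (parentNode a a≤B z) = level-parentNode a a≤B z

    parent≡nothing⇒root : ∀ k → parent k ≡ nothing → k ≡ toFin root
    parent≡nothing⇒root k e with fromFin k in eq | e
    ... | root | refl = trans (sym (toFin-fromFin k)) (cong toFin eq)

    toFin-leaf-injective : ∀ {x y} → toFin (leaf x) ≡ toFin (leaf y) → x ≡ y
    toFin-leaf-injective {x} {y} e =
      proj₂ (FinP.combine-injective {suc B} {n} top x top y (FinP.suc-injective e))
      where
      top : Fin (suc B)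
      top = fromℕ< (s≤s (ℕP.≤-refl {B}))

    tree : WeightedTree F n
    tree = record
      { m = size
      ; emb = toFin ∘ leaf
      ; emb-inj = λ x y → toFin-leaf-injective
      ; parent = parent
      ; wt = weight ∘ fromFin
      ; wt-nonneg = weight-nonNeg ∘ fromFin
      ; rank = level ∘ fromFin
      ; rank-dec = parent-decreases-level
      ; root = toFin root
      ; root-root = refl
      ; root-unique = parent≡nothing⇒root
      }

    open WalkProperties F tree

    wt-toFin : ∀ v → WeightedTree.wt tree (toFin v) ≈ weight v
    wt-toFin v = ≈-reflexive (cong weight (fromFin-toFin v))

    parent-toFin : ∀ a .(a≤B : a ≤ℕ B) z →
                   parent (toFin (node a a≤B z)) ≡ just (toFin (parentNode a a≤B z))
    parent-toFin a a≤B z = cong (Data.Maybe.map toFin ∘ parentOf) (fromFin-toFin (node a a≤B z))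

    siblingWalk : ∀ a .(a≤B : a ≤ℕ B) {u v} → cluster a u ≡ cluster a v →
      Σ (Walk F tree (toFin (node a a≤B u)) (toFin (node a a≤B v)))
        λ w → walkLength F tree w ≈ weight (node a a≤B u) + weight (node a a≤B v)
    siblingWalk a a≤B {u} {v} e =
      up (parent-toFin a a≤B u) (down v→parent here) ,
      +-cong (wt-toFin (node a a≤B u)) (≈-trans (+-identityʳ _) (wt-toFin (node a a≤B v)))
      where
      v→parent : parent (toFin (node a a≤B v)) ≡ just (toFin (parentNode a a≤B u))
      v→parent = trans (parent-toFin a a≤B v) (cong (just ∘ toFin) (sym (parentNode-cong a a≤B e)))

    walkInCluster : ∀ a .(a≤B : a ≤ℕ B) {i u v} → i ≤ℕ a → cluster i u ≡ cluster i v →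
      Σ (Walk F tree (toFin (node a a≤B u)) (toFin (node a a≤B v)))
        λ w → walkLength F tree w ≈ (height i - height (suc a)) + (height i - height (suc a))
    walkInCluster zero a≤B z≤n e = siblingWalk zero a≤B e
    walkInCluster (suc a) a<B {i} {u} {v} i≤a+1 e with ℕP.m≤n⇒m<n∨m≡n i≤a+1
    ... | inj₂ refl = siblingWalk (suc a) a<B e
    ... | inj₁ (s≤s i≤a)
        with walkInCluster a (ℕP.<⇒≤ a<B) i≤a
               (representative-preserves-cluster i≤a+1 (ℕP.m≤n⇒m≤1+n (recompute (suc a ≤ℕ? B) a<B)) e)
    ...   | w , w≈ = up (parent-toFin (suc a) a<B u) (snocDown w (parent-toFin (suc a) a<B v)) , length
      where
      X W : Carrier
      X = height i - height (suc a)
      W = height (suc a) - height (suc (suc a))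
      length : walkLength F tree (up (parent-toFin (suc a) a<B u) (snocDown w (parent-toFin (suc a) a<B v)))
               ≈ (height i - height (suc (suc a))) + (height i - height (suc (suc a)))
      length = begin
        _                  ≈⟨ +-cong (wt-toFin (node (suc a) a<B u)) (walkLength-snocDown w _) ⟩
        W + (walkLength F tree w + _) ≈⟨ +-congˡ (+-cong w≈ (wt-toFin (node (suc a) a<B v))) ⟩
        W + ((X + X) + W)  ≈⟨ x+[[y+y]+x]≈[y+x]+[y+x] W X ⟩
        (X + W) + (X + W)  ≈⟨ +-cong ([x-y]+[y-z]≈x-z _ _ _) ([x-y]+[y-z]≈x-z _ _ _) ⟩
        _                  ∎
        where open ≈-Reasoning

    leafWalk : ∀ {i x y} → i ≤ℕ B → cluster i x ≡ cluster i y →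
               Σ (Walk F tree (toFin (leaf x)) (toFin (leaf y))) λ w → walkLength F tree w ≈ Δ i
    leafWalk {i} i≤B e with walkInCluster B ℕP.≤-refl i≤B e
    ... | w , w≈ = w , ≈-trans w≈ (+-cong height-i≈ height-i≈)
      where
      height-i≈ : height i - height (suc B) ≈ height i
      height-i≈ = ≈-trans (+-congˡ (-‿cong height-leaf)) (x-0≈x _)

    lipschitz-fromFin : ∀ (f : Vertex → Carrier) →
      (∀ a .(a≤B : a ≤ℕ B) z → ∣ f (parentNode a a≤B z) - f (node a a≤B z) ∣≤ weight (node a a≤B z)) →
      EdgeLipschitz (f ∘ fromFin)
    lipschitz-fromFin f lip k p e with fromFin k | e
    ... | node a a≤B z | refl =
      subst (λ v → ∣ f v - f (node a a≤B z) ∣≤ weight (node a a≤B z))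
            (sym (fromFin-toFin (parentNode a a≤B z))) (lip a a≤B z)

    -- The potential is Δ i at the leaf y, 0 at every leaf outside y's level-(i + 1) cluster,
    -- and changes by at most the weight along each edge.
    module Potential (y : Fin n) (i : ℕ) where
      InBranch : ℕ → Fin n → Set
      InBranch L z = suc i ≤ℕ L × cluster (suc i) z ≡ cluster (suc i) y

      inBranch? : ∀ L z → Dec (InBranch L z)
      inBranch? L z = (suc i ≤ℕ? L) ×-dec MaybeP.≡-dec FinP._≟_ (cluster (suc i) z) (cluster (suc i) y)

      potentialAt : ℕ → Fin n → Carrier
      potentialAt L z with inBranch? L z
      ... | yes _ = Δ i - height L
      ... | no _ = height L

      potential : Vertex → Carrier
      potential root = height 0
      potential (node a _ z) = potentialAt (suc a) z

      potentialAt-inside : ∀ {L z} → InBranch L z → potentialAt L z ≡ Δ i - height L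
      potentialAt-inside {L} {z} z∈ with inBranch? L z
      ... | yes _ = refl
      ... | no z∉ = ⊥-elim (z∉ z∈)

      potentialAt-outside : ∀ {L z} → ¬ InBranch L z → potentialAt L z ≡ height L
      potentialAt-outside {L} {z} z∉ with inBranch? L z
      ... | yes z∈ = ⊥-elim (z∉ z∈)
      ... | no _ = refl

      potentialAt-edge : ∀ L r z → L ≤ℕ B → (suc i ≤ℕ L → cluster (suc i) r ≡ cluster (suc i) z) →
                         ∣ potentialAt L r - potentialAt (suc L) z ∣≤ height L - height (suc L)
      potentialAt-edge L r z L≤B r~z with inBranch? L r | inBranch? (suc L) z
      ... | yes _ | yes _ = y≤x⇒∣[z-x]-[z-y]∣≤x-y (Δ i) (height-antimono L≤B)
      ... | yes (i<L , r∈) | no z∉ = ⊥-elim (z∉ (ℕP.m≤n⇒m≤1+n i<L , trans (sym (r~z i<L)) r∈))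
      ... | no _ | no _ = y≤x⇒∣x-y∣≤x-y (height-antimono L≤B)
      ... | no r∉ | yes (i≤L , z∈) =
        subst (λ j → ∣ height L - ((height j + height j) - height (suc L)) ∣≤ height L - height (suc L))
              (sym i≡L) (y≤x⇒∣x-[[x+x]-y]∣≤x-y (height-antimono L≤B))
        where
        i≡L : i ≡ L
        i≡L = ℕP.≤-antisym (ℕP.≤-pred i≤L) (ℕP.≮⇒≥ λ i<L → r∉ (i<L , trans (r~z i<L) z∈))

      potential-lipschitz : ∀ a .(a≤B : a ≤ℕ B) z →
        ∣ potential (parentNode a a≤B z) - potential (node a a≤B z) ∣≤ weight (node a a≤B z)
      potential-lipschitz zero _ z = potentialAt-edge 0 z z z≤n (λ ())
      potential-lipschitz (suc a) a<B z =
        potentialAt-edge (suc a) (representative (suc a) z) z a+1≤B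
          (λ i<a+1 → cluster-representative z i<a+1 (ℕP.m≤n⇒m≤1+n a+1≤B))
        where
        a+1≤B : suc a ≤ℕ B
        a+1≤B = recompute (suc a ≤ℕ? B) a<B

    separated⇒Δ≤walkLength : ∀ {i x y} → i ≤ℕ B → cluster (suc i) x ≢ cluster (suc i) y →
      (w : Walk F tree (toFin (leaf x)) (toFin (leaf y))) → Δ i ≤ walkLength F tree w
    separated⇒Δ≤walkLength {i} {x} {y} i≤B x≁y w = begin
      Δ i                                    ≈⟨ ≈-sym (≈-trans (+-congˡ (-‿cong height-leaf)) (x-0≈x _)) ⟩
      Δ i - height (suc B)                   ≡⟨ sym (potentialAt-inside (s≤s i≤B , refl)) ⟩
      potential (leaf y)                     ≡⟨ cong potential (sym (fromFin-toFin (leaf y))) ⟩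
      potential (fromFin (toFin (leaf y)))   ≤⟨ EdgeLipschitz⇒≤walkLength _ lipschitz w ⟩
      potential (fromFin (toFin (leaf x))) + walkLength F tree w
        ≡⟨ cong (λ v → potential v + walkLength F tree w) (fromFin-toFin (leaf x)) ⟩
      potential (leaf x) + walkLength F tree w
        ≡⟨ cong (_+ walkLength F tree w) (potentialAt-outside {suc B} (x≁y ∘ proj₂)) ⟩
      height (suc B) + walkLength F tree w   ≈⟨ ≈-trans (+-congʳ height-leaf) (+-identityˡ _) ⟩
      walkLength F tree w                    ∎
      where
      open Potential y i
      open ≤-Reasoning
      lipschitz : EdgeLipschitz (potential ∘ fromFin)
      lipschitz = lipschitz-fromFin potential potential-lipschitz

    cluster≡⇒d≤Δ : ∀ {i x y} → x ≢ y → i ≤ℕ B → cluster i x ≡ cluster i y → d x y ≤ Δ i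
    cluster≡⇒d≤Δ {zero} {x} {y} x≢y _ _ =
      μ^i*δ≤dmax⇒δ≤Δi z≤n (≤-respˡʳ-≈ (≈-sym (*-identityˡ (d x y))) ≈-refl (proj₂ isMax x y x≢y))
    cluster≡⇒d≤Δ {suc i} {x} {y} _ i<B e =
      μ^i*δ≤dmax⇒δ≤Δi i<B (bounded H (suc i) i<B x y (cluster≡⇒part≡ i<B e))

    dominating : IsDominating F n d tree
    dominating x y w with x FinP.≟ y
    ... | yes refl =
      ≤-respˡʳ-≈ (≈-sym (proj₂ (IsMetric.zero-iff metric x x) refl)) ≈-refl (walkLength-nonNeg w)
    ... | no x≢y with lastCrossing B (λ i → toSum (MaybeP.≡-dec FinP._≟_ _ _))
                                     (x≢y ∘ cluster-leaf-injective) refl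
    ...   | i , i≤B , same , separated =
      ≤-trans (cluster≡⇒d≤Δ x≢y i≤B same) (separated⇒Δ≤walkLength i≤B separated w)

    inBall⇒cluster≡ : ∀ {i x y} → i ≤ℕ B →
      (∀ z → (μ ^ i) * d x z ≤ η * dmax → part H i z ≡ part H i x) →
      InBallAtScale i x y → cluster i x ≡ cluster i y
    inBall⇒cluster≡ {zero} _ _ _ = refl
    inBall⇒cluster≡ {suc i} {x} {y} i<B ball y∈ball = part≡⇒cluster≡ i<B (sym (ball y y∈ball))

    shortLeafWalk : ∀ {i x y} → i ≤ℕ B →
      (∀ z → (μ ^ i) * d x z ≤ η * dmax → part H i z ≡ part H i x) →
      InBallAtScale i x y → η * dmax ≤ (μ ^ suc i) * d x y →
      Σ (Walk F tree (toFin (leaf x)) (toFin (leaf y))) λ w → η * walkLength F tree w ≤ μ * d x y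
    shortLeafWalk i≤B ball y∈ball far with leafWalk i≤B (inBall⇒cluster≡ i≤B ball y∈ball)
    ... | w , w≈Δ = w , ≤-respˡʳ-≈ (*-congˡ (≈-sym w≈Δ)) ≈-refl (η*Δi≤μ*δ i≤B far)

  open HierarchyTree using (tree; dominating; shortLeafWalk)

  treeCover : ∀ k (H : Fin k → HierarchicalPartition F n d dmax μ B) →
              IsHPFamily F n d dmax η μ B k H → ∃[ T ] IsTreeCover F n d η μ k T
  treeCover k H family = tree ∘ H , dominating ∘ H , cover
    where
    cover : ∀ x y → x ≢ y →
      ∃[ j ] Σ (Walk F (tree (H j)) (WeightedTree.emb (tree (H j)) x) (WeightedTree.emb (tree (H j)) y))
               (λ w → η * walkLength F (tree (H j)) w ≤ μ * d x y)
    cover x y x≢y with separationScale x≢y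
    ... | i , i≤B , y∈ball , far with family x i i≤B
    ...   | j , ball = j , shortLeafWalk (H j) i≤B ball y∈ball far

mainTheorem6 :
    (F : OrderedField) → let open OrderedField F in
    (n : ℕ) (d : Fin n → Fin n → Carrier) → IsMetric F n d →
    (dmax dmin : Carrier) → IsMaxDist F n d dmax → IsMinDist F n d dmin →
    (η μ : Carrier) → 0# < η → η < 1# → 1# < μ →
    (B : ℕ) → dmax ≈ (μ ^ B) * dmin →
    (k : ℕ) (H : Fin k → HierarchicalPartition F n d dmax μ B) →
    IsHPFamily F n d dmax η μ B k H →
    ∃[ T ] IsTreeCover F n d η μ k T
mainTheorem6 F n d metric dmax dmin isMax isMin η μ _ η<1 1<μ B dmax≈μ^B*dmin =
  Construction.treeCover F metric isMax isMin η<1 1<μ B dmax≈μ^B*dmin
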